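{- Let $\ell=(i_1,\dots,i_l)$ be a finite nonempty ordered collection of positive integers, and define $\tilde\varphi_\ell(n)=\tilde\varphi_{i_1}(n)\cdots\tilde\varphi_{i_l}(n)$ for $n\in\mathbb{N}$. Then the limit $\lim_{n\to\infty}\frac{1}{n}\sum_{m=1}^n\tilde\varphi_\ell(m)$ exists and equals $\prod_p f_\ell\!\left(\frac{1}{p}\right)$, where $f_\ell(t)=1-t\left(1-\prod_{j=1}^l(1-t^{i_j})\right)$.
   Context: For a positive integer $k$, $\tilde\varphi_k:\mathbb{N}\to\mathbb{R}$ is defined by $\tilde\varphi_k(p_1^{l_1}\cdots p_m^{l_m})=\prod_{r=1}^m\left(1-\frac{1}{p_r^k}\right)$, where $p_1,\dots,p_m$ are pairwise distinct primes and $l_r\ge1$ (so $\tilde\varphi_k(1)=1$). $\prod_p$ denotes the product over all primes. -}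

module Defs where

open import Data.Nat as ℕ using (ℕ; zero; suc; _≤_)
open import Data.Nat.Primality using (Prime; prime?)
open import Data.Nat.Divisibility using (_∣_; _∣?_)
open import Data.Integer using (+_)
open import Data.Rational using (ℚ; 0ℚ; 1ℚ; _+_; _*_; _-_; _/_)
open import Data.List using (List; []; _∷_; filter; map; foldr; upTo)
open import Data.List.NonEmpty using (List⁺; toList)
open import Relation.Nullary.Decidable using (_×-dec_)

-- reciprocal of a natural number as a rational (inv 0 = 0 by convention; only used for n ≥ 1)
inv : ℕ → ℚ
inv zero    = 0ℚ
inv (suc n) = (+ 1) / suc n

_^ℚ_ : ℚ → ℕ → ℚ
q ^ℚ zero  = 1ℚ
q ^ℚ suc k = q * (q ^ℚ k)

prodℚ : List ℚ → ℚ
prodℚ = foldr _*_ 1ℚ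

sumℚ : List ℚ → ℚ
sumℚ = foldr _+_ 0ℚ

primeDivisors : ℕ → List ℕ
primeDivisors n = filter (λ p → prime? p ×-dec p ∣? n) (upTo (suc n))

primesUpTo : ℕ → List ℕ
primesUpTo P = filter prime? (upTo (suc P))

φ̃ : ℕ → ℕ → ℚ
φ̃ k n = prodℚ (map (λ p → 1ℚ - (inv p ^ℚ k)) (primeDivisors n))

φ̃ℓ : List⁺ ℕ → ℕ → ℚ
φ̃ℓ ℓ n = prodℚ (map (λ i → φ̃ i n) (toList ℓ))

average : List⁺ ℕ → ℕ → ℚ
average ℓ n = inv n * sumℚ (map (λ m → φ̃ℓ ℓ (suc m)) (upTo n))

fℓ : List⁺ ℕ → ℚ → ℚ
fℓ ℓ t = 1ℚ - t * (1ℚ - prodℚ (map (λ i → 1ℚ - (t ^ℚ i)) (toList ℓ)))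

partialProduct : List⁺ ℕ → ℕ → ℚ
partialProduct ℓ P = prodℚ (map (λ p → fℓ ℓ (inv p)) (primesUpTo P))

{-# OPTIONS --safe #-}

-- φ̃ℓ(m) is the product over k ≤ m of local factors, equal to g(1/k) = ∏ⱼ (1 - k^(-iⱼ)) when k is
-- a prime dividing m and to 1 otherwise.  Truncating it to k < K changes it by at most
-- Σ_{k ≥ K, k ∣ m} L/k (L the length of ℓ), which averages over m ≤ n to at most
-- L Σ_{k ≥ K} 1/k² ≤ L/(K - 1).  The truncated product is periodic modulo the product Q of the
-- primes below K, and its mean over a period is ∏_{p<K} fℓ(1/p): a new prime p divides a
-- proportion 1/p of the integers of a period, and at a multiple j p the old factors are those of j,
-- so the mean gets multiplied by 1 - (1/p)(1 - g(1/p)) = fℓ(1/p).  The same bound L/k² on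
-- 1 - fℓ(1/k) makes the partial Euler products Cauchy, and altogether
-- |average n - ∏_{p ≤ P} fℓ(1/p)| ≤ 2L/(K - 1) + (1 + Q)/n whenever P + 1 ≥ K.

module Submission where

open import Defs
open import Data.Nat using (ℕ; _≤_; NonZero)
open import Data.Rational using (ℚ; 0ℚ; _<_; _-_; ∣_∣)
open import Data.List.NonEmpty using (List⁺; toList)
import Data.List.NonEmpty as List⁺
open import Data.List.Relation.Unary.All using (All)
open import Data.Product using (∃-syntax)

open import Algebra.Bundles using (CommutativeRing)
open import Data.Bool using (true; false; if_then_else_)
open import Data.Integer using (1ℤ)
import Data.Integer as ℤ
open import Data.Integer.Tactic.RingSolver using (solve-∀)
open import Data.List using (List; []; _∷_; map; filter; applyUpTo; upTo; length)
import Data.List.Relation.Unary.All as All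
open import Data.Nat using (zero; suc)
import Data.Nat as ℕ
import Data.Nat.DivMod as ℕ
import Data.Nat.Divisibility as ℕ
import Data.Nat.Properties as ℕₚ
open import Data.Nat.Divisibility using (_∣_; _∣?_)
open import Data.Nat.Primality using (Prime; prime?; ¬prime[1]; euclidsLemma; prime⇒irreducible; prime⇒nonZero)
open import Data.Product using (_×_; _,_; proj₁; proj₂)
open import Data.Rational using (1ℚ; _+_; _*_; -_; mkℚ; toℚᵘ)
import Data.Rational as ℚ
import Data.Rational.Properties as ℚₚ
import Algebra.Properties.Semiring.Mult (CommutativeRing.semiring ℚₚ.+-*-commutativeRing) as Mult
open import Data.Rational.Solver using (module +-*-Solver)
import Data.Rational.Unnormalised as ℚᵘ
import Data.Rational.Unnormalised.Properties as ℚᵘₚ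
open import Data.Sum using (inj₁; inj₂)
open import Function using (_∘_)
open import Relation.Binary.PropositionalEquality
open import Relation.Nullary using (yes; no; ¬_; does; contradiction)
open import Relation.Nullary.Decidable using (_×-dec_)
open import Relation.Unary using (Decidable)

open +-*-Solver using (solve; _:+_; _:*_; _:-_; :-_; _:=_; con)

ι : ℕ → ℚ
ι n = n Mult.× 1ℚ

ι-+ : ∀ m n → ι (m ℕ.+ n) ≡ ι m + ι n
ι-+ = Mult.×-homo-+ 1ℚ

ι-* : ∀ m n → ι (m ℕ.* n) ≡ ι m * ι n
ι-* = Mult.×1-homo-*

0≤1 : 0ℚ ℚ.≤ 1ℚ
0≤1 = ℚₚ.nonNegative⁻¹ 1ℚ

ι-nonNeg : ∀ n → 0ℚ ℚ.≤ ι n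
ι-nonNeg zero    = ℚₚ.≤-refl
ι-nonNeg (suc n) = ℚₚ.+-mono-≤ 0≤1 (ι-nonNeg n)

ι-mono-≤ : ∀ {m n} → m ≤ n → ι m ℚ.≤ ι n
ι-mono-≤ {m} {n} m≤n = begin
  ι m                     ≡⟨ ℚₚ.+-identityʳ (ι m) ⟨
  ι m + 0ℚ                ≤⟨ ℚₚ.+-monoʳ-≤ (ι m) (ι-nonNeg (n ℕ.∸ m)) ⟩
  ι m + ι (n ℕ.∸ m)       ≡⟨ ι-+ m (n ℕ.∸ m) ⟨
  ι (m ℕ.+ (n ℕ.∸ m))     ≡⟨ cong ι (ℕₚ.m+[n∸m]≡n m≤n) ⟩
  ι n                     ∎
  where open ℚₚ.≤-Reasoning

toℚᵘ-ι : ∀ n → toℚᵘ (ι n) ℚᵘ.≃ ℚᵘ.mkℚᵘ (ℤ.+ n) 0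
toℚᵘ-ι zero    = ℚᵘₚ.≃-refl
toℚᵘ-ι (suc n) = ℚᵘₚ.≃-trans (ℚₚ.toℚᵘ-homo-+ 1ℚ (ι n))
  (ℚᵘₚ.≃-trans (ℚᵘₚ.+-congʳ (toℚᵘ 1ℚ) (toℚᵘ-ι n)) (ℚᵘ.*≡* (cross-multiplied (ℤ.+ n))))
  where
  cross-multiplied : ∀ x → (1ℤ ℤ.* 1ℤ ℤ.+ x ℤ.* 1ℤ) ℤ.* 1ℤ ≡ (1ℤ ℤ.+ x) ℤ.* (1ℤ ℤ.* 1ℤ)
  cross-multiplied = solve-∀

ι*inv≡1 : ∀ n .{{_ : NonZero n}} → ι n * inv n ≡ 1ℚ
ι*inv≡1 (suc n) = ℚₚ.toℚᵘ-injective (ℚᵘₚ.≃-trans (ℚₚ.toℚᵘ-homo-* (ι (suc n)) (inv (suc n)))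
  (ℚᵘₚ.≃-trans (ℚᵘₚ.*-cong (toℚᵘ-ι (suc n)) (ℚₚ.toℚᵘ-fromℚᵘ (ℚᵘ.mkℚᵘ (ℤ.+ 1) n))) (ℚᵘ.*≡* (cross-multiplied (ℤ.+ suc n)))))
  where
  cross-multiplied : ∀ x → (x ℤ.* 1ℤ) ℤ.* 1ℤ ≡ 1ℤ ℤ.* (1ℤ ℤ.* x)
  cross-multiplied = solve-∀

*-monoˡ-≤ : ∀ {r p q} → 0ℚ ℚ.≤ r → p ℚ.≤ q → r * p ℚ.≤ r * q
*-monoˡ-≤ {r} 0≤r = ℚₚ.*-monoˡ-≤-nonNeg r {{ℚ.nonNegative 0≤r}}

*-monoʳ-≤ : ∀ {r p q} → 0ℚ ℚ.≤ r → p ℚ.≤ q → p * r ℚ.≤ q * r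
*-monoʳ-≤ {r} 0≤r = ℚₚ.*-monoʳ-≤-nonNeg r {{ℚ.nonNegative 0≤r}}

*-nonNeg : ∀ {p q} → 0ℚ ℚ.≤ p → 0ℚ ℚ.≤ q → 0ℚ ℚ.≤ p * q
*-nonNeg {p} {q} 0≤p 0≤q = ℚₚ.nonNegative⁻¹ (p * q)
  {{ℚₚ.nonNeg*nonNeg⇒nonNeg p {{ℚ.nonNegative 0≤p}} q {{ℚ.nonNegative 0≤q}}}}

inv-nonNeg : ∀ n → 0ℚ ℚ.≤ inv n
inv-nonNeg zero    = ℚₚ.≤-refl
inv-nonNeg (suc n) = ℚₚ.nonNegative⁻¹ (inv (suc n)) {{ℚₚ.normalize-nonNeg 1 (suc n)}}

inv-pos : ∀ n .{{_ : NonZero n}} → 0ℚ < inv n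
inv-pos (suc n) = ℚₚ.positive⁻¹ (inv (suc n)) {{ℚₚ.normalize-pos 1 (suc n)}}

inv-unique : ∀ n .{{_ : NonZero n}} {y} → ι n * y ≡ 1ℚ → y ≡ inv n
inv-unique n {y} ny≡1 = begin
  y                  ≡⟨ ℚₚ.*-identityʳ y ⟨
  y * 1ℚ             ≡⟨ cong (y *_) (ι*inv≡1 n) ⟨
  y * (ι n * inv n)  ≡⟨ solve 3 (λ y c i → y :* (c :* i) := (c :* y) :* i) refl y (ι n) (inv n) ⟩
  (ι n * y) * inv n  ≡⟨ cong (_* inv n) ny≡1 ⟩
  1ℚ * inv n         ≡⟨ ℚₚ.*-identityˡ (inv n) ⟩
  inv n              ∎
  where open ≡-Reasoning

ι*inv[*]≡inv : ∀ m n .{{_ : NonZero m}} .{{_ : NonZero n}} → ι m * inv (m ℕ.* n) ≡ inv n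
ι*inv[*]≡inv m n = inv-unique n (begin
  ι n * (ι m * inv (m ℕ.* n))  ≡⟨ solve 3 (λ x y z → x :* (y :* z) := (y :* x) :* z) refl (ι n) (ι m) (inv (m ℕ.* n)) ⟩
  (ι m * ι n) * inv (m ℕ.* n)  ≡⟨ cong (_* inv (m ℕ.* n)) (ι-* m n) ⟨
  ι (m ℕ.* n) * inv (m ℕ.* n)  ≡⟨ ι*inv≡1 (m ℕ.* n) {{ℕₚ.m*n≢0 m n}} ⟩
  1ℚ                           ∎)
  where open ≡-Reasoning

inv-antimono-≤ : ∀ {m n} .{{_ : NonZero m}} → m ≤ n → inv n ℚ.≤ inv m
inv-antimono-≤ {m@(suc _)} {n@(suc _)} m≤n = begin
  inv n                  ≡⟨ ℚₚ.*-identityʳ (inv n) ⟨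
  inv n * 1ℚ             ≡⟨ cong (inv n *_) (ι*inv≡1 m) ⟨
  inv n * (ι m * inv m)  ≤⟨ *-monoˡ-≤ (inv-nonNeg n) (*-monoʳ-≤ (inv-nonNeg m) (ι-mono-≤ m≤n)) ⟩
  inv n * (ι n * inv m)  ≡⟨ ℚₚ.*-assoc (inv n) (ι n) (inv m) ⟨
  (inv n * ι n) * inv m  ≡⟨ cong (_* inv m) (trans (ℚₚ.*-comm (inv n) (ι n)) (ι*inv≡1 n)) ⟩
  1ℚ * inv m             ≡⟨ ℚₚ.*-identityˡ (inv m) ⟩
  inv m                  ∎
  where open ℚₚ.≤-Reasoning

inv≤1 : ∀ n → inv n ℚ.≤ 1ℚ
inv≤1 zero    = 0≤1
inv≤1 (suc n) = inv-antimono-≤ {1} {suc n} (ℕ.s≤s ℕ.z≤n)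

inv[n]-inv[1+n]≡inv[n]*inv[1+n] : ∀ n .{{_ : NonZero n}} → inv n - inv (suc n) ≡ inv n * inv (suc n)
inv[n]-inv[1+n]≡inv[n]*inv[1+n] n = begin
  a - b                                ≡⟨ cong₂ _-_ (ℚₚ.*-identityʳ a) (ℚₚ.*-identityʳ b) ⟨
  a * 1ℚ - b * 1ℚ                      ≡⟨ cong₂ (λ u v → a * u - b * v) (ι*inv≡1 (suc n)) (ι*inv≡1 n) ⟨
  a * (ι (suc n) * b) - b * (ι n * a)  ≡⟨ solve 3 (λ a b c → a :* ((con 1ℚ :+ c) :* b) :- b :* (c :* a) := a :* b) refl a b (ι n) ⟩
  a * b                                ∎
  where
  open ≡-Reasoning
  a = inv n
  b = inv (suc n)

inv[1+n]*inv[1+n]≤inv[n]-inv[1+n] : ∀ n .{{_ : NonZero n}} → inv (suc n) * inv (suc n) ℚ.≤ inv n - inv (suc n)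
inv[1+n]*inv[1+n]≤inv[n]-inv[1+n] n = begin
  inv (suc n) * inv (suc n)  ≤⟨ *-monoʳ-≤ (inv-nonNeg (suc n)) (inv-antimono-≤ (ℕₚ.n≤1+n n)) ⟩
  inv n * inv (suc n)        ≡⟨ inv[n]-inv[1+n]≡inv[n]*inv[1+n] n ⟨
  inv n - inv (suc n)        ∎
  where open ℚₚ.≤-Reasoning

p≤q⇒0≤q-p : ∀ {p q} → p ℚ.≤ q → 0ℚ ℚ.≤ q - p
p≤q⇒0≤q-p {p} {q} p≤q = begin
  0ℚ     ≡⟨ ℚₚ.+-inverseʳ p ⟨
  p - p  ≤⟨ ℚₚ.+-monoˡ-≤ (- p) p≤q ⟩
  q - p  ∎
  where open ℚₚ.≤-Reasoning

p≤q+r⇒p-q≤r : ∀ {p q r} → p ℚ.≤ q + r → p - q ℚ.≤ r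
p≤q+r⇒p-q≤r {p} {q} {r} p≤q+r = begin
  p - q        ≤⟨ ℚₚ.+-monoˡ-≤ (- q) p≤q+r ⟩
  (q + r) - q  ≡⟨ solve 2 (λ q r → (q :+ r) :- q := r) refl q r ⟩
  r            ∎
  where open ℚₚ.≤-Reasoning

0≤q⇒p-q≤p : ∀ {p q} → 0ℚ ℚ.≤ q → p - q ℚ.≤ p
0≤q⇒p-q≤p {p} {q} 0≤q = p≤q+r⇒p-q≤r (begin
  p      ≡⟨ ℚₚ.+-identityˡ p ⟨
  0ℚ + p ≤⟨ ℚₚ.+-monoˡ-≤ p 0≤q ⟩
  q + p  ∎)
  where open ℚₚ.≤-Reasoning

∣p-r∣≤∣p-q∣+∣q-r∣ : ∀ p q r → ∣ p - r ∣ ℚ.≤ ∣ p - q ∣ + ∣ q - r ∣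
∣p-r∣≤∣p-q∣+∣q-r∣ p q r = subst (ℚ._≤ ∣ p - q ∣ + ∣ q - r ∣)
  (cong ∣_∣ (solve 3 (λ p q r → (p :- q) :+ (q :- r) := p :- r) refl p q r))
  (ℚₚ.∣p+q∣≤∣p∣+∣q∣ (p - q) (q - r))

infix 4 _∈[0,_] _∈[0,1]

_∈[0,_] : ℚ → ℚ → Set
x ∈[0, r ] = 0ℚ ℚ.≤ x × x ℚ.≤ r

_∈[0,1] : ℚ → Set
x ∈[0,1] = x ∈[0, 1ℚ ]

∈[0,]-mono : ∀ {x r s} → x ∈[0, r ] → r ℚ.≤ s → x ∈[0, s ]
∈[0,]-mono (0≤x , x≤r) r≤s = 0≤x , ℚₚ.≤-trans x≤r r≤s

∈[0,r]⇒∣∣≤r : ∀ {x r} → x ∈[0, r ] → ∣ x ∣ ℚ.≤ r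
∈[0,r]⇒∣∣≤r (0≤x , x≤r) = subst (ℚ._≤ _) (sym (ℚₚ.0≤p⇒∣p∣≡p 0≤x)) x≤r

∣p-q∣≤r : ∀ {p q r} → p ∈[0, r ] → q ∈[0, r ] → ∣ p - q ∣ ℚ.≤ r
∣p-q∣≤r {p} {q} {r} (0≤p , p≤r) (0≤q , q≤r) with ℚₚ.∣p∣≡p∨∣p∣≡-p (p - q)
... | inj₁ ∣p-q∣≡p-q = subst (ℚ._≤ r) (sym ∣p-q∣≡p-q) (ℚₚ.≤-trans (0≤q⇒p-q≤p 0≤q) p≤r)
... | inj₂ ∣p-q∣≡q-p = subst (ℚ._≤ r) (sym ∣p-q∣≡q-p)
  (subst (ℚ._≤ r) (solve 2 (λ p q → q :- p := :- (p :- q)) refl p q) (ℚₚ.≤-trans (0≤q⇒p-q≤p 0≤p) q≤r))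

∈[0,1]-* : ∀ {x y} → x ∈[0,1] → y ∈[0,1] → x * y ∈[0,1]
∈[0,1]-* {x} {y} (0≤x , x≤1) (0≤y , y≤1) = *-nonNeg 0≤x 0≤y , (begin
  x * y   ≤⟨ *-monoʳ-≤ 0≤y x≤1 ⟩
  1ℚ * y  ≡⟨ ℚₚ.*-identityˡ y ⟩
  y       ≤⟨ y≤1 ⟩
  1ℚ      ∎)
  where open ℚₚ.≤-Reasoning

1-∈[0,1] : ∀ {x} → x ∈[0,1] → 1ℚ - x ∈[0,1]
1-∈[0,1] (0≤x , x≤1) = p≤q⇒0≤q-p x≤1 , 0≤q⇒p-q≤p 0≤x

1-x*y≤[1-x]+[1-y] : ∀ {x y} → x ∈[0,1] → y ℚ.≤ 1ℚ → 1ℚ - x * y ℚ.≤ (1ℚ - x) + (1ℚ - y)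
1-x*y≤[1-x]+[1-y] {x} {y} (0≤x , x≤1) y≤1 = begin
  1ℚ - x * y                ≡⟨ solve 2 (λ x y → con 1ℚ :- x :* y := (con 1ℚ :- x) :+ x :* (con 1ℚ :- y)) refl x y ⟩
  (1ℚ - x) + x * (1ℚ - y)   ≤⟨ ℚₚ.+-monoʳ-≤ (1ℚ - x) (*-monoʳ-≤ (p≤q⇒0≤q-p y≤1) x≤1) ⟩
  (1ℚ - x) + 1ℚ * (1ℚ - y)  ≡⟨ cong ((1ℚ - x) +_) (ℚₚ.*-identityˡ (1ℚ - y)) ⟩
  (1ℚ - x) + (1ℚ - y)       ∎
  where open ℚₚ.≤-Reasoning

∑< : ℕ → (ℕ → ℚ) → ℚ
∑< zero    f = 0ℚ
∑< (suc n) f = ∑< n f + f n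

∏< : ℕ → (ℕ → ℚ) → ℚ
∏< zero    f = 1ℚ
∏< (suc n) f = ∏< n f * f n

infix 2 ∑< ∏<
syntax ∑< n (λ k → e) = ∑[ k < n ] e
syntax ∏< n (λ k → e) = ∏[ k < n ] e

∑-cong : ∀ n {f g} → (∀ k → k ℕ.< n → f k ≡ g k) → ∑< n f ≡ ∑< n g
∑-cong zero    f≡g = refl
∑-cong (suc n) f≡g = cong₂ _+_ (∑-cong n (λ k k<n → f≡g k (ℕₚ.m<n⇒m<1+n k<n))) (f≡g n (ℕₚ.n<1+n n))

∏-cong : ∀ n {f g} → (∀ k → k ℕ.< n → f k ≡ g k) → ∏< n f ≡ ∏< n g
∏-cong zero    f≡g = refl
∏-cong (suc n) f≡g = cong₂ _*_ (∏-cong n (λ k k<n → f≡g k (ℕₚ.m<n⇒m<1+n k<n))) (f≡g n (ℕₚ.n<1+n n))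

∑-split : ∀ m n f → ∑< (m ℕ.+ n) f ≡ ∑< m f + (∑[ j < n ] f (m ℕ.+ j))
∑-split m zero    f rewrite ℕₚ.+-identityʳ m = sym (ℚₚ.+-identityʳ (∑< m f))
∑-split m (suc n) f rewrite ℕₚ.+-suc m n =
  trans (cong (_+ f (m ℕ.+ n)) (∑-split m n f)) (ℚₚ.+-assoc (∑< m f) _ (f (m ℕ.+ n)))

∏-split : ∀ m n f → ∏< (m ℕ.+ n) f ≡ ∏< m f * (∏[ j < n ] f (m ℕ.+ j))
∏-split m zero    f rewrite ℕₚ.+-identityʳ m = sym (ℚₚ.*-identityʳ (∏< m f))
∏-split m (suc n) f rewrite ℕₚ.+-suc m n =
  trans (cong (_* f (m ℕ.+ n)) (∏-split m n f)) (ℚₚ.*-assoc (∏< m f) _ (f (m ℕ.+ n)))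

∑-shift : ∀ n f → ∑< (suc n) f ≡ f 0 + (∑[ j < n ] f (suc j))
∑-shift n f = trans (∑-split 1 n f) (cong (_+ ∑< n (f ∘ suc)) (ℚₚ.+-identityˡ (f 0)))

∏-shift : ∀ n f → ∏< (suc n) f ≡ f 0 * (∏[ j < n ] f (suc j))
∏-shift n f = trans (∏-split 1 n f) (cong (_* ∏< n (f ∘ suc)) (ℚₚ.*-identityˡ (f 0)))

∑-const : ∀ n c → (∑[ _ < n ] c) ≡ ι n * c
∑-const zero    c = sym (ℚₚ.*-zeroˡ c)
∑-const (suc n) c = trans (cong (_+ c) (∑-const n c)) (solve 2 (λ x c → x :* c :+ c := (con 1ℚ :+ x) :* c) refl (ι n) c)

∑-zero : ∀ n → (∑[ _ < n ] 0ℚ) ≡ 0ℚ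
∑-zero n = trans (∑-const n 0ℚ) (ℚₚ.*-zeroʳ (ι n))

∏-one : ∀ n → (∏[ _ < n ] 1ℚ) ≡ 1ℚ
∏-one zero    = refl
∏-one (suc n) = cong (_* 1ℚ) (∏-one n)

∑-distrib-+ : ∀ n f g → (∑[ k < n ] (f k + g k)) ≡ ∑< n f + ∑< n g
∑-distrib-+ zero    f g = refl
∑-distrib-+ (suc n) f g = trans (cong (_+ (f n + g n)) (∑-distrib-+ n f g))
  (solve 4 (λ a b c d → (a :+ b) :+ (c :+ d) := (a :+ c) :+ (b :+ d)) refl (∑< n f) (∑< n g) (f n) (g n))

∑-distrib-- : ∀ n f g → (∑[ k < n ] (f k - g k)) ≡ ∑< n f - ∑< n g
∑-distrib-- zero    f g = refl
∑-distrib-- (suc n) f g = trans (cong (_+ (f n - g n)) (∑-distrib-- n f g))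
  (solve 4 (λ a b c d → (a :- b) :+ (c :- d) := (a :+ c) :- (b :+ d)) refl (∑< n f) (∑< n g) (f n) (g n))

∑-distribˡ-* : ∀ n c f → (∑[ k < n ] (c * f k)) ≡ c * ∑< n f
∑-distribˡ-* zero    c f = sym (ℚₚ.*-zeroʳ c)
∑-distribˡ-* (suc n) c f = trans (cong (_+ c * f n) (∑-distribˡ-* n c f)) (sym (ℚₚ.*-distribˡ-+ c (∑< n f) (f n)))

∑-comm : ∀ m n (F : ℕ → ℕ → ℚ) → (∑[ i < m ] ∑[ j < n ] F i j) ≡ (∑[ j < n ] ∑[ i < m ] F i j)
∑-comm zero    n F = sym (∑-zero n)
∑-comm (suc m) n F = trans (cong (_+ ∑< n (F m)) (∑-comm m n F)) (sym (∑-distrib-+ n (λ j → ∑[ i < m ] F i j) (F m)))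

∑-mono-≤ : ∀ n {f g} → (∀ k → k ℕ.< n → f k ℚ.≤ g k) → ∑< n f ℚ.≤ ∑< n g
∑-mono-≤ zero    f≤g = ℚₚ.≤-refl
∑-mono-≤ (suc n) f≤g = ℚₚ.+-mono-≤ (∑-mono-≤ n (λ k k<n → f≤g k (ℕₚ.m<n⇒m<1+n k<n))) (f≤g n (ℕₚ.n<1+n n))

∑-∈[0,] : ∀ n {f r} → (∀ k → k ℕ.< n → f k ∈[0, r k ]) → ∑< n f ∈[0, ∑< n r ]
∑-∈[0,] n {f} f∈ =
  subst (ℚ._≤ ∑< n f) (∑-zero n) (∑-mono-≤ n (λ k k<n → proj₁ (f∈ k k<n))) ,
  ∑-mono-≤ n (λ k k<n → proj₂ (f∈ k k<n))

∑-telescope : ∀ n (a : ℕ → ℚ) → (∑[ j < n ] (a j - a (suc j))) ≡ a 0 - a n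
∑-telescope zero    a = sym (ℚₚ.+-inverseʳ (a 0))
∑-telescope (suc n) a = trans (cong (_+ (a n - a (suc n))) (∑-telescope n a))
  (solve 3 (λ x y z → (x :- y) :+ (y :- z) := x :- z) refl (a 0) (a n) (a (suc n)))

∏-∈[0,1] : ∀ n {a} → (∀ k → a k ∈[0,1]) → ∏< n a ∈[0,1]
∏-∈[0,1] zero    a∈ = 0≤1 , ℚₚ.≤-refl
∏-∈[0,1] (suc n) a∈ = ∈[0,1]-* (∏-∈[0,1] n a∈) (a∈ n)

1-∏≤∑1- : ∀ n {a} → (∀ k → a k ∈[0,1]) → 1ℚ - ∏< n a ℚ.≤ (∑[ k < n ] (1ℚ - a k))
1-∏≤∑1- zero    a∈ = ℚₚ.≤-reflexive (ℚₚ.+-inverseʳ 1ℚ)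
1-∏≤∑1- (suc n) {a} a∈ = begin
  1ℚ - ∏< n a * a n                      ≤⟨ 1-x*y≤[1-x]+[1-y] (∏-∈[0,1] n a∈) (proj₂ (a∈ n)) ⟩
  (1ℚ - ∏< n a) + (1ℚ - a n)             ≤⟨ ℚₚ.+-monoˡ-≤ (1ℚ - a n) (1-∏≤∑1- n a∈) ⟩
  (∑[ k < n ] (1ℚ - a k)) + (1ℚ - a n)   ∎
  where open ℚₚ.≤-Reasoning

∏-truncation : ∀ {a} → (∀ k → a k ∈[0,1]) → ∀ m n →
  ∏< m a - ∏< (m ℕ.+ n) a ∈[0, ∑[ j < n ] (1ℚ - a (m ℕ.+ j)) ]
∏-truncation {a} a∈ m n = subst (_∈[0, S ]) (sym head-tail) (*-nonNeg 0≤P 0≤1-R , (begin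
  P * (1ℚ - R)                     ≤⟨ *-monoʳ-≤ 0≤1-R P≤1 ⟩
  1ℚ * (1ℚ - R)                    ≡⟨ ℚₚ.*-identityˡ (1ℚ - R) ⟩
  1ℚ - R                           ≤⟨ 1-∏≤∑1- n (a∈ ∘ (m ℕ.+_)) ⟩
  S                                ∎))
  where
  open ℚₚ.≤-Reasoning
  P = ∏< m a
  R = ∏[ j < n ] a (m ℕ.+ j)
  S = ∑[ j < n ] (1ℚ - a (m ℕ.+ j))
  0≤P = proj₁ (∏-∈[0,1] m a∈)
  P≤1 = proj₂ (∏-∈[0,1] m a∈)
  0≤1-R = proj₁ (1-∈[0,1] (∏-∈[0,1] n (a∈ ∘ (m ℕ.+_))))
  head-tail : P - ∏< (m ℕ.+ n) a ≡ P * (1ℚ - R)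
  head-tail = trans (cong (λ z → P - z) (∏-split m n a)) (solve 2 (λ P R → P :- P :* R := P :* (con 1ℚ :- R)) refl P R)

∑-inv²-tail : ∀ K d → (∑[ j < d ] (inv (suc (suc K) ℕ.+ j) * inv (suc (suc K) ℕ.+ j))) ℚ.≤ inv (suc K)
∑-inv²-tail K d = begin
  (∑[ j < d ] (inv (suc (suc K) ℕ.+ j) * inv (suc (suc K) ℕ.+ j)))  ≤⟨ ∑-mono-≤ d (λ j _ → term≤ j) ⟩
  (∑[ j < d ] (a j - a (suc j)))                                    ≡⟨ ∑-telescope d a ⟩
  a 0 - a d                                                         ≤⟨ 0≤q⇒p-q≤p (inv-nonNeg (suc K ℕ.+ d)) ⟩
  a 0                                                               ≡⟨ cong (inv ∘ suc) (ℕₚ.+-identityʳ K) ⟩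
  inv (suc K)                                                       ∎
  where
  open ℚₚ.≤-Reasoning
  a : ℕ → ℚ
  a j = inv (suc K ℕ.+ j)
  b : ℕ → ℚ
  b j = inv (suc (suc K) ℕ.+ j)
  term≤ : ∀ j → b j * b j ℚ.≤ a j - a (suc j)
  term≤ j = subst (λ i → b j * b j ℚ.≤ a j - inv (suc i)) (sym (ℕₚ.+-suc K j)) (inv[1+n]*inv[1+n]≤inv[n]-inv[1+n] (suc K ℕ.+ j))

onMultiples : ℕ → (ℕ → ℚ) → ℕ → ℚ
onMultiples k a m = if does (k ∣? m) then a m else 0ℚ

onMultiples-∣ : ∀ {k m} a → k ∣ m → onMultiples k a m ≡ a m
onMultiples-∣ {k} {m} a k∣m with k ∣? m
... | yes _  = refl
... | no k∤m = contradiction k∣m k∤m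

onMultiples-∤ : ∀ {k m} a → ¬ k ∣ m → onMultiples k a m ≡ 0ℚ
onMultiples-∤ {k} {m} a k∤m with k ∣? m
... | yes k∣m = contradiction k∣m k∤m
... | no _    = refl

∑-onMultiples-block : ∀ k .{{_ : NonZero k}} t a →
  (∑[ r < k ] onMultiples k a (t ℕ.* k ℕ.+ r)) ≡ a (t ℕ.* k)
∑-onMultiples-block (suc k) t a = begin
  (∑[ r < suc k ] onMultiples (suc k) a (tk ℕ.+ r))                 ≡⟨ ∑-shift k _ ⟩
  onMultiples (suc k) a (tk ℕ.+ 0) + (∑[ r < k ] onMultiples (suc k) a (tk ℕ.+ suc r))
    ≡⟨ cong₂ _+_ (onMultiples-∣ a (subst (suc k ∣_) (sym (ℕₚ.+-identityʳ tk)) (ℕ.n∣m*n t)))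
                 (trans (∑-cong k (λ r r<k → onMultiples-∤ a (∤tk+[1+r] r r<k))) (∑-zero k)) ⟩
  a (tk ℕ.+ 0) + 0ℚ                                                 ≡⟨ ℚₚ.+-identityʳ _ ⟩
  a (tk ℕ.+ 0)                                                      ≡⟨ cong a (ℕₚ.+-identityʳ tk) ⟩
  a tk                                                              ∎
  where
  open ≡-Reasoning
  tk = t ℕ.* suc k
  ∤tk+[1+r] : ∀ r → r ℕ.< k → ¬ suc k ∣ tk ℕ.+ suc r
  ∤tk+[1+r] r r<k k∣ = ℕ.>⇒∤ (ℕ.s≤s r<k) (ℕ.∣m+n∣m⇒∣n k∣ (ℕ.n∣m*n t))

∑-onMultiples : ∀ k .{{_ : NonZero k}} T a →
  (∑[ m < T ℕ.* k ] onMultiples k a m) ≡ (∑[ t < T ] a (t ℕ.* k))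
∑-onMultiples k zero    a = refl
∑-onMultiples k (suc T) a = begin
  ∑< (k ℕ.+ T ℕ.* k) (onMultiples k a)  ≡⟨ cong (λ N → ∑< N (onMultiples k a)) (ℕₚ.+-comm k (T ℕ.* k)) ⟩
  ∑< (T ℕ.* k ℕ.+ k) (onMultiples k a)  ≡⟨ ∑-split (T ℕ.* k) k (onMultiples k a) ⟩
  ∑< (T ℕ.* k) (onMultiples k a) + (∑[ r < k ] onMultiples k a (T ℕ.* k ℕ.+ r))
    ≡⟨ cong₂ _+_ (∑-onMultiples k T a) (∑-onMultiples-block k T a) ⟩
  (∑[ t < T ] a (t ℕ.* k)) + a (T ℕ.* k) ∎
  where open ≡-Reasoning

∑-mono-≤-length : ∀ {m n f} → (∀ k → 0ℚ ℚ.≤ f k) → m ≤ n → ∑< m f ℚ.≤ ∑< n f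
∑-mono-≤-length {m} {n} {f} 0≤f m≤n = begin
  ∑< m f                                    ≡⟨ ℚₚ.+-identityʳ (∑< m f) ⟨
  ∑< m f + 0ℚ                               ≤⟨ ℚₚ.+-monoʳ-≤ (∑< m f) (proj₁ (∑-∈[0,] (n ℕ.∸ m) (λ j _ → 0≤f (m ℕ.+ j) , ℚₚ.≤-refl))) ⟩
  ∑< m f + (∑[ j < n ℕ.∸ m ] f (m ℕ.+ j))   ≡⟨ ∑-split m (n ℕ.∸ m) f ⟨
  ∑< (m ℕ.+ (n ℕ.∸ m)) f                    ≡⟨ cong (λ N → ∑< N f) (ℕₚ.m+[n∸m]≡n m≤n) ⟩
  ∑< n f                                    ∎
  where open ℚₚ.≤-Reasoning

ι[n/k]≤ι[n]*inv[k] : ∀ n k .{{_ : NonZero k}} → ι (n ℕ./ k) ℚ.≤ ι n * inv k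
ι[n/k]≤ι[n]*inv[k] n k = begin
  ι q                   ≡⟨ ℚₚ.*-identityʳ (ι q) ⟨
  ι q * 1ℚ              ≡⟨ cong (ι q *_) (ι*inv≡1 k) ⟨
  ι q * (ι k * inv k)   ≡⟨ ℚₚ.*-assoc (ι q) (ι k) (inv k) ⟨
  (ι q * ι k) * inv k   ≡⟨ cong (_* inv k) (ι-* q k) ⟨
  ι (q ℕ.* k) * inv k   ≤⟨ *-monoʳ-≤ (inv-nonNeg k) (ι-mono-≤ (ℕ.m/n*n≤m n k)) ⟩
  ι n * inv k           ∎
  where
  open ℚₚ.≤-Reasoning
  q = n ℕ./ k

∑-onMultiples-suc-≤ : ∀ k .{{_ : NonZero k}} n {c} → 0ℚ ℚ.≤ c →
  (∑[ m < n ] onMultiples k (λ _ → c) (suc m)) ℚ.≤ ι n * inv k * c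
∑-onMultiples-suc-≤ k n {c} 0≤c = begin
  ∑< n (f ∘ suc)                  ≡⟨ solve 2 (λ c x → x := (c :+ x) :- c) refl c (∑< n (f ∘ suc)) ⟩
  (c + ∑< n (f ∘ suc)) - c        ≡⟨ cong (λ z → (z + ∑< n (f ∘ suc)) - c) (onMultiples-∣ (λ _ → c) (k ℕ.∣0)) ⟨
  (f 0 + ∑< n (f ∘ suc)) - c      ≡⟨ cong (_- c) (∑-shift n f) ⟨
  ∑< (suc n) f - c                ≤⟨ ℚₚ.+-monoˡ-≤ (- c) (∑-mono-≤-length 0≤f 1+n≤[1+q]*k) ⟩
  ∑< (suc q ℕ.* k) f - c          ≡⟨ cong (_- c) (trans (∑-onMultiples k (suc q) (λ _ → c)) (∑-const (suc q) c)) ⟩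
  ι (suc q) * c - c               ≡⟨ solve 2 (λ x c → (con 1ℚ :+ x) :* c :- c := x :* c) refl (ι q) c ⟩
  ι q * c                         ≤⟨ *-monoʳ-≤ 0≤c (ι[n/k]≤ι[n]*inv[k] n k) ⟩
  ι n * inv k * c                 ∎
  where
  open ℚₚ.≤-Reasoning
  f = onMultiples k (λ _ → c)
  q = n ℕ./ k
  0≤f : ∀ m → 0ℚ ℚ.≤ f m
  0≤f m with k ∣? m
  ... | yes _ = 0≤c
  ... | no _  = ℚₚ.≤-refl
  1+n≤[1+q]*k : suc n ≤ suc q ℕ.* k
  1+n≤[1+q]*k = subst (λ x → suc x ≤ k ℕ.+ q ℕ.* k) (sym (ℕ.m≡m%n+[m/n]*n n k))
    (ℕₚ.+-monoˡ-≤ (q ℕ.* k) (ℕ.m%n<n n k))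

module _ {A : Set} where

  prodℚ-map-1 : ∀ (xs : List A) → prodℚ (map (λ _ → 1ℚ) xs) ≡ 1ℚ
  prodℚ-map-1 []       = refl
  prodℚ-map-1 (x ∷ xs) = trans (cong (1ℚ *_) (prodℚ-map-1 xs)) (ℚₚ.*-identityˡ 1ℚ)

  prodℚ-map-* : ∀ (a b : A → ℚ) xs → prodℚ (map (λ x → a x * b x) xs) ≡ prodℚ (map a xs) * prodℚ (map b xs)
  prodℚ-map-* a b []       = sym (ℚₚ.*-identityˡ 1ℚ)
  prodℚ-map-* a b (x ∷ xs) = trans (cong (a x * b x *_) (prodℚ-map-* a b xs))
    (solve 4 (λ p q r s → (p :* q) :* (r :* s) := (p :* r) :* (q :* s)) refl (a x) (b x) (prodℚ (map a xs)) (prodℚ (map b xs)))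

  prodℚ-map-filter : ∀ {P : A → Set} (P? : Decidable P) (F : A → ℚ) xs →
    prodℚ (map F (filter P? xs)) ≡ prodℚ (map (λ x → if does (P? x) then F x else 1ℚ) xs)
  prodℚ-map-filter P? F []       = refl
  prodℚ-map-filter P? F (x ∷ xs) with does (P? x)
  ... | true  = cong (F x *_) (prodℚ-map-filter P? F xs)
  ... | false = trans (prodℚ-map-filter P? F xs) (sym (ℚₚ.*-identityˡ _))

prodℚ-map-comm : ∀ {A B : Set} (F : A → B → ℚ) xs ys →
  prodℚ (map (λ x → prodℚ (map (F x) ys)) xs) ≡ prodℚ (map (λ y → prodℚ (map (λ x → F x y) xs)) ys)
prodℚ-map-comm F []       ys = sym (prodℚ-map-1 ys)
prodℚ-map-comm F (x ∷ xs) ys = trans (cong (prodℚ (map (F x) ys) *_) (prodℚ-map-comm F xs ys))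
  (sym (prodℚ-map-* (F x) (λ y → prodℚ (map (λ x → F x y) xs)) ys))

prodℚ-map-applyUpTo : ∀ (F : ℕ → ℚ) g n → prodℚ (map F (applyUpTo g n)) ≡ (∏[ k < n ] F (g k))
prodℚ-map-applyUpTo F g zero    = refl
prodℚ-map-applyUpTo F g (suc n) =
  trans (cong (F (g 0) *_) (prodℚ-map-applyUpTo F (g ∘ suc) n)) (sym (∏-shift n (F ∘ g)))

sumℚ-map-applyUpTo : ∀ (F : ℕ → ℚ) g n → sumℚ (map F (applyUpTo g n)) ≡ (∑[ k < n ] F (g k))
sumℚ-map-applyUpTo F g zero    = refl
sumℚ-map-applyUpTo F g (suc n) =
  trans (cong (F (g 0) +_) (sumℚ-map-applyUpTo F (g ∘ suc) n)) (sym (∑-shift n (F ∘ g)))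

-- fℓ ℓ t is 1 - t * (1 - g (toList ℓ) t) by definition, and φ̃ℓ ℓ (p ^ a) is g (toList ℓ) (1/p).
g : List ℕ → ℚ → ℚ
g is x = prodℚ (map (λ i → 1ℚ - x ^ℚ i) is)

localFactor : List ℕ → ℕ → ℕ → ℚ
localFactor is m k = if does (prime? k ×-dec k ∣? m) then g is (inv k) else 1ℚ

eulerFactor : List⁺ ℕ → ℕ → ℚ
eulerFactor ℓ k = if does (prime? k) then fℓ ℓ (inv k) else 1ℚ

φ̃ℓ< : List ℕ → ℕ → ℕ → ℚ
φ̃ℓ< is K m = ∏[ k < K ] localFactor is m k

eulerProduct< : List⁺ ℕ → ℕ → ℚ
eulerProduct< ℓ K = ∏[ k < K ] eulerFactor ℓ k

φ̃ℓ≡φ̃ℓ< : ∀ ℓ m → φ̃ℓ ℓ m ≡ φ̃ℓ< (toList ℓ) (suc m) m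
φ̃ℓ≡φ̃ℓ< ℓ m = begin
  φ̃ℓ ℓ m
    ≡⟨ prodℚ-map-comm (λ i p → 1ℚ - inv p ^ℚ i) (toList ℓ) (primeDivisors m) ⟩
  prodℚ (map (g (toList ℓ) ∘ inv) (primeDivisors m))
    ≡⟨ prodℚ-map-filter (λ p → prime? p ×-dec p ∣? m) (g (toList ℓ) ∘ inv) (upTo (suc m)) ⟩
  prodℚ (map (localFactor (toList ℓ) m) (upTo (suc m)))
    ≡⟨ prodℚ-map-applyUpTo (localFactor (toList ℓ) m) (λ k → k) (suc m) ⟩
  φ̃ℓ< (toList ℓ) (suc m) m
    ∎
  where open ≡-Reasoning

partialProduct≡eulerProduct< : ∀ ℓ P → partialProduct ℓ P ≡ eulerProduct< ℓ (suc P)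
partialProduct≡eulerProduct< ℓ P =
  trans (prodℚ-map-filter prime? (fℓ ℓ ∘ inv) (upTo (suc P))) (prodℚ-map-applyUpTo (eulerFactor ℓ) (λ k → k) (suc P))

average≡ : ∀ ℓ n → average ℓ n ≡ inv n * (∑[ m < n ] φ̃ℓ< (toList ℓ) (suc (suc m)) (suc m))
average≡ ℓ n = cong (inv n *_) (trans (sumℚ-map-applyUpTo (φ̃ℓ ℓ ∘ suc) (λ k → k) n)
  (∑-cong n (λ m _ → φ̃ℓ≡φ̃ℓ< ℓ (suc m))))

^-∈[0,1] : ∀ {x} i → x ∈[0,1] → x ^ℚ i ∈[0,1]
^-∈[0,1] zero    x∈ = 0≤1 , ℚₚ.≤-refl
^-∈[0,1] (suc i) x∈ = ∈[0,1]-* x∈ (^-∈[0,1] i x∈)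

^≤ : ∀ {x} i .{{_ : NonZero i}} → x ∈[0,1] → x ^ℚ i ℚ.≤ x
^≤ {x} (suc i) x∈@(0≤x , _) = begin
  x * x ^ℚ i  ≤⟨ *-monoˡ-≤ 0≤x (proj₂ (^-∈[0,1] i x∈)) ⟩
  x * 1ℚ      ≡⟨ ℚₚ.*-identityʳ x ⟩
  x           ∎
  where open ℚₚ.≤-Reasoning

g-∈[0,1] : ∀ is {x} → x ∈[0,1] → g is x ∈[0,1]
g-∈[0,1] []       x∈ = 0≤1 , ℚₚ.≤-refl
g-∈[0,1] (i ∷ is) x∈ = ∈[0,1]-* (1-∈[0,1] (^-∈[0,1] i x∈)) (g-∈[0,1] is x∈)

1-g≤ : ∀ {is x} → All NonZero is → x ∈[0,1] → 1ℚ - g is x ℚ.≤ ι (length is) * x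
1-g≤ {[]}     {x} All.[]         x∈ = ℚₚ.≤-reflexive (trans (ℚₚ.+-inverseʳ 1ℚ) (sym (ℚₚ.*-zeroˡ x)))
1-g≤ {i ∷ is} {x} (i≢0 All.∷ nz) x∈ = begin
  1ℚ - (1ℚ - x ^ℚ i) * g is x                 ≤⟨ 1-x*y≤[1-x]+[1-y] (1-∈[0,1] (^-∈[0,1] i x∈)) (proj₂ (g-∈[0,1] is x∈)) ⟩
  (1ℚ - (1ℚ - x ^ℚ i)) + (1ℚ - g is x)        ≡⟨ cong (_+ (1ℚ - g is x)) (solve 1 (λ y → con 1ℚ :- (con 1ℚ :- y) := y) refl (x ^ℚ i)) ⟩
  x ^ℚ i + (1ℚ - g is x)                      ≤⟨ ℚₚ.+-mono-≤ (^≤ i {{i≢0}} x∈) (1-g≤ nz x∈) ⟩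
  x + ι (length is) * x                       ≡⟨ solve 2 (λ x n → x :+ n :* x := (con 1ℚ :+ n) :* x) refl x (ι (length is)) ⟩
  ι (length (i ∷ is)) * x                     ∎
  where open ℚₚ.≤-Reasoning

localFactor-∈[0,1] : ∀ is m k → localFactor is m k ∈[0,1]
localFactor-∈[0,1] is m k with prime? k | k ∣? m
... | yes _ | yes _ = g-∈[0,1] is (inv-nonNeg k , inv≤1 k)
... | no _  | _     = 0≤1 , ℚₚ.≤-refl
... | yes _ | no _  = 0≤1 , ℚₚ.≤-refl

1-localFactor≤ : ∀ {is} → All NonZero is → ∀ m k →
  1ℚ - localFactor is m k ℚ.≤ onMultiples k (λ _ → ι (length is) * inv k) m
1-localFactor≤ {is} nz m k with prime? k | k ∣? m
... | yes _ | yes _ = 1-g≤ nz (inv-nonNeg k , inv≤1 k)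
... | no _  | yes _ = *-nonNeg (ι-nonNeg (length is)) (inv-nonNeg k)
... | yes _ | no _  = ℚₚ.≤-refl
... | no _  | no _  = ℚₚ.≤-refl

eulerFactor-∈[0,1] : ∀ ℓ k → eulerFactor ℓ k ∈[0,1]
eulerFactor-∈[0,1] ℓ k with prime? k
... | yes _ = 1-∈[0,1] (∈[0,1]-* (inv-nonNeg k , inv≤1 k) (1-∈[0,1] (g-∈[0,1] (toList ℓ) (inv-nonNeg k , inv≤1 k))))
... | no _  = 0≤1 , ℚₚ.≤-refl

1-eulerFactor≤ : ∀ {ℓ} → All NonZero (toList ℓ) → ∀ k →
  1ℚ - eulerFactor ℓ k ℚ.≤ ι (length (toList ℓ)) * (inv k * inv k)
1-eulerFactor≤ {ℓ} nz k with prime? k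
... | no _  = *-nonNeg (ι-nonNeg (length (toList ℓ))) (*-nonNeg (inv-nonNeg k) (inv-nonNeg k))
... | yes _ = begin
  1ℚ - (1ℚ - t * (1ℚ - g is t))  ≡⟨ solve 1 (λ y → con 1ℚ :- (con 1ℚ :- y) := y) refl (t * (1ℚ - g is t)) ⟩
  t * (1ℚ - g is t)              ≤⟨ *-monoˡ-≤ (inv-nonNeg k) (1-g≤ nz (inv-nonNeg k , inv≤1 k)) ⟩
  t * (ι (length is) * t)        ≡⟨ solve 2 (λ t n → t :* (n :* t) := n :* (t :* t)) refl t (ι (length is)) ⟩
  ι (length is) * (t * t)        ∎
  where
  open ℚₚ.≤-Reasoning
  is = toList ℓ
  t = inv k

localFactor-∤ : ∀ is {m k} → ¬ k ∣ m → localFactor is m k ≡ 1ℚ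
localFactor-∤ is {m} {k} k∤m with prime? k | k ∣? m
... | _     | yes k∣m = contradiction k∣m k∤m
... | yes _ | no _    = refl
... | no _  | no _    = refl

φ̃ℓ<-stable : ∀ is {m N} .{{_ : NonZero m}} → m ℕ.< N → φ̃ℓ< is N m ≡ φ̃ℓ< is (suc m) m
φ̃ℓ<-stable is {m} {N} m<N = begin
  φ̃ℓ< is N m
    ≡⟨ cong (λ N → φ̃ℓ< is N m) (ℕₚ.m+[n∸m]≡n m<N) ⟨
  φ̃ℓ< is (suc m ℕ.+ d) m
    ≡⟨ ∏-split (suc m) d (localFactor is m) ⟩
  φ̃ℓ< is (suc m) m * (∏[ j < d ] localFactor is m (suc m ℕ.+ j))
    ≡⟨ cong (φ̃ℓ< is (suc m) m *_) (trans (∏-cong d (λ j _ → localFactor-∤ is (ℕ.>⇒∤ (ℕₚ.m≤m+n (suc m) j)))) (∏-one d)) ⟩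
  φ̃ℓ< is (suc m) m * 1ℚ
    ≡⟨ ℚₚ.*-identityʳ _ ⟩
  φ̃ℓ< is (suc m) m
    ∎
  where
  open ≡-Reasoning
  d = N ℕ.∸ suc m

∑-φ̃ℓ<-truncation : ∀ {is} → All NonZero is → ∀ K n →
  (∑[ m < n ] (φ̃ℓ< is (suc (suc K)) (suc m) - φ̃ℓ< is (suc (suc m)) (suc m)))
    ∈[0, ι (length is) * ι n * inv (suc K) ]
∑-φ̃ℓ<-truncation {is} nz K n = proj₁ (∑-∈[0,] n error-at) , (begin
  (∑[ m < n ] (φ̃ℓ< is K₂ (suc m) - φ̃ℓ< is (suc (suc m)) (suc m)))
                                                                 ≤⟨ proj₂ (∑-∈[0,] n error-at) ⟩
  (∑[ m < n ] ∑[ j < suc n ] e (suc m) (K₂ ℕ.+ j))              ≡⟨ ∑-comm n (suc n) (λ m j → e (suc m) (K₂ ℕ.+ j)) ⟩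
  (∑[ j < suc n ] ∑[ m < n ] e (suc m) (K₂ ℕ.+ j))              ≤⟨ ∑-mono-≤ (suc n) (λ j _ → multiples≤ (K₂ ℕ.+ j)) ⟩
  (∑[ j < suc n ] (L * ι n) * (inv (K₂ ℕ.+ j) * inv (K₂ ℕ.+ j))) ≡⟨ ∑-distribˡ-* (suc n) (L * ι n) _ ⟩
  L * ι n * (∑[ j < suc n ] (inv (K₂ ℕ.+ j) * inv (K₂ ℕ.+ j)))   ≤⟨ *-monoˡ-≤ (*-nonNeg (ι-nonNeg (length is)) (ι-nonNeg n)) (∑-inv²-tail K (suc n)) ⟩
  L * ι n * inv (suc K)                                          ∎)
  where
  open ℚₚ.≤-Reasoning
  K₂ = suc (suc K)
  L = ι (length is)
  e : ℕ → ℕ → ℚ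
  e m k = onMultiples k (λ _ → L * inv k) m
  error-at : ∀ m → m ℕ.< n →
    φ̃ℓ< is K₂ (suc m) - φ̃ℓ< is (suc (suc m)) (suc m) ∈[0, ∑[ j < suc n ] e (suc m) (K₂ ℕ.+ j) ]
  error-at m m<n = subst (λ z → φ̃ℓ< is K₂ (suc m) - z ∈[0, ∑[ j < suc n ] e (suc m) (K₂ ℕ.+ j) ])
    (φ̃ℓ<-stable is (ℕₚ.<-≤-trans (ℕ.s≤s m<n) (ℕₚ.m≤n+m (suc n) K₂)))
    (∈[0,]-mono (∏-truncation (localFactor-∈[0,1] is (suc m)) K₂ (suc n))
      (∑-mono-≤ (suc n) (λ j _ → 1-localFactor≤ nz (suc m) (K₂ ℕ.+ j))))
  multiples≤ : ∀ k .{{_ : NonZero k}} → (∑[ m < n ] e (suc m) k) ℚ.≤ (L * ι n) * (inv k * inv k)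
  multiples≤ k = ℚₚ.≤-trans (∑-onMultiples-suc-≤ k n (*-nonNeg (ι-nonNeg (length is)) (inv-nonNeg k)))
    (ℚₚ.≤-reflexive (solve 3 (λ n i L → n :* i :* (L :* i) := (L :* n) :* (i :* i)) refl (ι n) (inv k) L))

prime∣m*p⇒∣m : ∀ {k p} m → Prime k → Prime p → k ℕ.< p → k ∣ m ℕ.* p → k ∣ m
prime∣m*p⇒∣m m pk pp k<p k∣m*p with euclidsLemma m _ pk k∣m*p
... | inj₁ k∣m = k∣m
... | inj₂ k∣p with prime⇒irreducible pp k∣p
...   | inj₁ refl = contradiction pk ¬prime[1]
...   | inj₂ refl = contradiction k<p (ℕₚ.<-irrefl refl)

localFactor-*-prime : ∀ is {p k} m → Prime p → k ℕ.< p → localFactor is (m ℕ.* p) k ≡ localFactor is m k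
localFactor-*-prime is {p} {k} m pp k<p with prime? k | k ∣? m ℕ.* p | k ∣? m
... | no _   | _         | _       = refl
... | yes _  | yes _     | yes _   = refl
... | yes _  | no _      | no _    = refl
... | yes pk | yes k∣m*p | no k∤m  = contradiction (prime∣m*p⇒∣m m pk pp k<p k∣m*p) k∤m
... | yes _  | no k∤m*p  | yes k∣m = contradiction (ℕ.∣m⇒∣m*n p k∣m) k∤m*p

φ̃ℓ<-*-prime : ∀ is {p} m → Prime p → φ̃ℓ< is p (m ℕ.* p) ≡ φ̃ℓ< is p m
φ̃ℓ<-*-prime is {p} m pp = ∏-cong p (λ k k<p → localFactor-*-prime is m pp k<p)

primorial : ℕ → ℕ
primorial zero    = 1
primorial (suc K) = primorial K ℕ.* (if does (prime? K) then K else 1)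

primorial-nonZero : ∀ K → NonZero (primorial K)
primorial-nonZero zero    = _
primorial-nonZero (suc K) with prime? K
... | yes pK = ℕₚ.m*n≢0 (primorial K) K {{primorial-nonZero K}} {{prime⇒nonZero pK}}
... | no _   = ℕₚ.m*n≢0 (primorial K) 1 {{primorial-nonZero K}}

∑-φ̃ℓ<-period-prime : ∀ ℓ {p} → Prime p →
  (∀ t → (∑[ m < t ℕ.* primorial p ] φ̃ℓ< (toList ℓ) p m) ≡ ι (t ℕ.* primorial p) * eulerProduct< ℓ p) → ∀ t →
  (∑[ m < t ℕ.* (primorial p ℕ.* p) ] (φ̃ℓ< (toList ℓ) p m * (if does (p ∣? m) then g (toList ℓ) (inv p) else 1ℚ)))
    ≡ ι (t ℕ.* (primorial p ℕ.* p)) * (eulerProduct< ℓ p * fℓ ℓ (inv p))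
∑-φ̃ℓ<-period-prime ℓ {p} pp period t = begin
  ∑< (t ℕ.* (Q ℕ.* p)) (λ m → H m * γ-if m)
    ≡⟨ cong (λ N → ∑< N (λ m → H m * γ-if m)) N≡T*p ⟩
  ∑< (T ℕ.* p) (λ m → H m * γ-if m)
    ≡⟨ ∑-cong (T ℕ.* p) (λ m _ → H*γ-if m) ⟩
  (∑[ m < T ℕ.* p ] (H m - (1ℚ - γ) * onMultiples p H m))
    ≡⟨ trans (∑-distrib-- (T ℕ.* p) H _) (cong (λ z → ∑< (T ℕ.* p) H - z) (∑-distribˡ-* (T ℕ.* p) (1ℚ - γ) _)) ⟩
  ∑< (T ℕ.* p) H - (1ℚ - γ) * ∑< (T ℕ.* p) (onMultiples p H)
    ≡⟨ cong₂ (λ a b → a - (1ℚ - γ) * b) ∑H ∑H-onMultiples ⟩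
  ι (T ℕ.* p) * E - (1ℚ - γ) * (ι T * E)
    ≡⟨ cong (λ x → x * E - (1ℚ - γ) * (ι T * E)) (ι-* T p) ⟩
  ι T * ι p * E - (1ℚ - γ) * (ι T * E)
    ≡⟨ cong (λ u → ι T * ι p * E - u) (ℚₚ.*-identityʳ ((1ℚ - γ) * (ι T * E))) ⟨
  ι T * ι p * E - (1ℚ - γ) * (ι T * E) * 1ℚ
    ≡⟨ cong (λ u → ι T * ι p * E - (1ℚ - γ) * (ι T * E) * u) (ι*inv≡1 p) ⟨
  ι T * ι p * E - (1ℚ - γ) * (ι T * E) * (ι p * inv p)
    ≡⟨ solve 5 (λ T P E γ i → T :* P :* E :- (con 1ℚ :- γ) :* (T :* E) :* (P :* i)
                              := T :* P :* (E :* (con 1ℚ :- i :* (con 1ℚ :- γ)))) refl (ι T) (ι p) E γ (inv p) ⟩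
  ι T * ι p * (E * fℓ ℓ (inv p))
    ≡⟨ cong (λ x → x * (E * fℓ ℓ (inv p))) (trans (sym (ι-* T p)) (cong ι (sym N≡T*p))) ⟩
  ι (t ℕ.* (Q ℕ.* p)) * (E * fℓ ℓ (inv p))
    ∎
  where
  open ≡-Reasoning
  instance
    p≢0 : NonZero p
    p≢0 = prime⇒nonZero pp
  Q = primorial p
  T = t ℕ.* Q
  H = φ̃ℓ< (toList ℓ) p
  E = eulerProduct< ℓ p
  γ = g (toList ℓ) (inv p)
  γ-if : ℕ → ℚ
  γ-if m = if does (p ∣? m) then γ else 1ℚ
  N≡T*p : t ℕ.* (Q ℕ.* p) ≡ T ℕ.* p
  N≡T*p = sym (ℕₚ.*-assoc t Q p)
  T*p≡[t*p]*Q : T ℕ.* p ≡ (t ℕ.* p) ℕ.* Q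
  T*p≡[t*p]*Q = trans (ℕₚ.*-assoc t Q p) (trans (cong (t ℕ.*_) (ℕₚ.*-comm Q p)) (sym (ℕₚ.*-assoc t p Q)))
  H*γ-if : ∀ m → H m * γ-if m ≡ H m - (1ℚ - γ) * onMultiples p H m
  H*γ-if m with p ∣? m
  ... | yes _ = solve 2 (λ h γ → h :* γ := h :- (con 1ℚ :- γ) :* h) refl (H m) γ
  ... | no _  = solve 2 (λ h γ → h :* con 1ℚ := h :- (con 1ℚ :- γ) :* con 0ℚ) refl (H m) γ
  ∑H : ∑< (T ℕ.* p) H ≡ ι (T ℕ.* p) * E
  ∑H = trans (cong (λ N → ∑< N H) T*p≡[t*p]*Q)
    (trans (period (t ℕ.* p)) (cong (λ N → ι N * E) (sym T*p≡[t*p]*Q)))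
  ∑H-onMultiples : ∑< (T ℕ.* p) (onMultiples p H) ≡ ι T * E
  ∑H-onMultiples = trans (∑-onMultiples p T H) (trans (∑-cong T (λ j _ → φ̃ℓ<-*-prime (toList ℓ) j pp)) (period t))

∑-φ̃ℓ<-period : ∀ ℓ K t → (∑[ m < t ℕ.* primorial K ] φ̃ℓ< (toList ℓ) K m) ≡ ι (t ℕ.* primorial K) * eulerProduct< ℓ K
∑-φ̃ℓ<-period ℓ zero    t = ∑-const (t ℕ.* 1) 1ℚ
∑-φ̃ℓ<-period ℓ (suc K) t with prime? K
... | yes pK = ∑-φ̃ℓ<-period-prime ℓ pK (∑-φ̃ℓ<-period ℓ K) t
... | no _ rewrite ℕₚ.*-identityʳ (primorial K) = trans (∑-cong (t ℕ.* primorial K) (λ m _ → ℚₚ.*-identityʳ _))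
  (trans (∑-φ̃ℓ<-period ℓ K t) (cong (ι (t ℕ.* primorial K) *_) (sym (ℚₚ.*-identityʳ _))))

*-∈[0,] : ∀ {c x} → 0ℚ ℚ.≤ c → x ∈[0,1] → c * x ∈[0, c ]
*-∈[0,] {c} {x} 0≤c (0≤x , x≤1) = *-nonNeg 0≤c 0≤x , (begin
  c * x   ≤⟨ *-monoˡ-≤ 0≤c x≤1 ⟩
  c * 1ℚ  ≡⟨ ℚₚ.*-identityʳ c ⟩
  c       ∎)
  where open ℚₚ.≤-Reasoning

∑-∈[0,ι] : ∀ n {f} → (∀ k → f k ∈[0,1]) → ∑< n f ∈[0, ι n ]
∑-∈[0,ι] n {f} f∈ = subst (∑< n f ∈[0,_]) (trans (∑-const n 1ℚ) (ℚₚ.*-identityʳ (ι n))) (∑-∈[0,] n (λ k _ → f∈ k))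

∣∑-shift-∑∣≤1 : ∀ n {f} → (∀ k → f k ∈[0,1]) → ∣ (∑[ m < n ] f (suc m)) - ∑< n f ∣ ℚ.≤ 1ℚ
∣∑-shift-∑∣≤1 n {f} f∈ = subst (ℚ._≤ 1ℚ) (cong ∣_∣ (sym difference)) (∣p-q∣≤r (f∈ n) (f∈ 0))
  where
  open ≡-Reasoning
  difference : (∑[ m < n ] f (suc m)) - ∑< n f ≡ f n - f 0
  difference = begin
    (∑[ m < n ] f (suc m)) - ∑< n f
      ≡⟨ solve 3 (λ a b c → a :- b := (c :+ a) :- (b :+ c)) refl (∑< n (f ∘ suc)) (∑< n f) (f 0) ⟩
    (f 0 + (∑[ m < n ] f (suc m))) - (∑< n f + f 0)
      ≡⟨ cong (λ z → z - (∑< n f + f 0)) (∑-shift n f) ⟨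
    (∑< n f + f n) - (∑< n f + f 0)
      ≡⟨ solve 3 (λ a b c → (a :+ b) :- (a :+ c) := b :- c) refl (∑< n f) (f n) (f 0) ⟩
    f n - f 0
      ∎

φ̃ℓ<-∈[0,1] : ∀ is K m → φ̃ℓ< is K m ∈[0,1]
φ̃ℓ<-∈[0,1] is K m = ∏-∈[0,1] K (localFactor-∈[0,1] is m)

eulerProduct<-∈[0,1] : ∀ ℓ K → eulerProduct< ℓ K ∈[0,1]
eulerProduct<-∈[0,1] ℓ K = ∏-∈[0,1] K (eulerFactor-∈[0,1] ℓ)

∣∑φ̃ℓ<-ι*eulerProduct<∣≤primorial : ∀ ℓ K n →
  ∣ (∑[ m < n ] φ̃ℓ< (toList ℓ) K m) - ι n * eulerProduct< ℓ K ∣ ℚ.≤ ι (primorial K)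
∣∑φ̃ℓ<-ι*eulerProduct<∣≤primorial ℓ K n = begin
  ∣ ∑< n H - ι n * E ∣                    ≡⟨ cong (λ N → ∣ ∑< N H - ι N * E ∣) n≡q*Q+r ⟩
  ∣ ∑< (q ℕ.* Q ℕ.+ r) H - ι (q ℕ.* Q ℕ.+ r) * E ∣
    ≡⟨ cong ∣_∣ remainder ⟩
  ∣ (∑[ j < r ] H (q ℕ.* Q ℕ.+ j)) - ι r * E ∣
    ≤⟨ ∣p-q∣≤r (∑-∈[0,ι] r (λ j → φ̃ℓ<-∈[0,1] (toList ℓ) K (q ℕ.* Q ℕ.+ j)))
               (*-∈[0,] (ι-nonNeg r) (eulerProduct<-∈[0,1] ℓ K)) ⟩
  ι r                                     ≤⟨ ι-mono-≤ (ℕₚ.<⇒≤ (ℕ.m%n<n n Q)) ⟩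
  ι Q                                     ∎
  where
  open ℚₚ.≤-Reasoning
  H = φ̃ℓ< (toList ℓ) K
  E = eulerProduct< ℓ K
  Q = primorial K
  instance
    Q≢0 : NonZero Q
    Q≢0 = primorial-nonZero K
  q = n ℕ./ Q
  r = n ℕ.% Q
  n≡q*Q+r : n ≡ q ℕ.* Q ℕ.+ r
  n≡q*Q+r = trans (ℕ.m≡m%n+[m/n]*n n Q) (ℕₚ.+-comm r (q ℕ.* Q))
  remainder : ∑< (q ℕ.* Q ℕ.+ r) H - ι (q ℕ.* Q ℕ.+ r) * E ≡ (∑[ j < r ] H (q ℕ.* Q ℕ.+ j)) - ι r * E
  remainder = begin-equality
    ∑< (q ℕ.* Q ℕ.+ r) H - ι (q ℕ.* Q ℕ.+ r) * E
      ≡⟨ cong₂ (λ a b → a - b * E) (∑-split (q ℕ.* Q) r H) (ι-+ (q ℕ.* Q) r) ⟩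
    (∑< (q ℕ.* Q) H + (∑[ j < r ] H (q ℕ.* Q ℕ.+ j))) - (ι (q ℕ.* Q) + ι r) * E
      ≡⟨ cong (λ z → (z + (∑[ j < r ] H (q ℕ.* Q ℕ.+ j))) - (ι (q ℕ.* Q) + ι r) * E) (∑-φ̃ℓ<-period ℓ K q) ⟩
    (ι (q ℕ.* Q) * E + (∑[ j < r ] H (q ℕ.* Q ℕ.+ j))) - (ι (q ℕ.* Q) + ι r) * E
      ≡⟨ solve 4 (λ a e x b → (a :* e :+ x) :- (a :+ b) :* e := x :- b :* e) refl (ι (q ℕ.* Q)) E (∑[ j < r ] H (q ℕ.* Q ℕ.+ j)) (ι r) ⟩
    (∑[ j < r ] H (q ℕ.* Q ℕ.+ j)) - ι r * E
      ∎

∣eulerProduct<-eulerProduct<∣ : ∀ {ℓ} → All NonZero (toList ℓ) → ∀ K d →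
  ∣ eulerProduct< ℓ (suc (suc K)) - eulerProduct< ℓ (suc (suc K) ℕ.+ d) ∣ ℚ.≤ ι (length (toList ℓ)) * inv (suc K)
∣eulerProduct<-eulerProduct<∣ {ℓ} nz K d = begin
  ∣ eulerProduct< ℓ K₂ - eulerProduct< ℓ (K₂ ℕ.+ d) ∣
    ≤⟨ ∈[0,r]⇒∣∣≤r (∏-truncation (eulerFactor-∈[0,1] ℓ) K₂ d) ⟩
  (∑[ j < d ] (1ℚ - eulerFactor ℓ (K₂ ℕ.+ j)))
    ≤⟨ ∑-mono-≤ d (λ j _ → 1-eulerFactor≤ nz (K₂ ℕ.+ j)) ⟩
  (∑[ j < d ] L * (inv (K₂ ℕ.+ j) * inv (K₂ ℕ.+ j)))
    ≡⟨ ∑-distribˡ-* d L _ ⟩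
  L * (∑[ j < d ] (inv (K₂ ℕ.+ j) * inv (K₂ ℕ.+ j)))
    ≤⟨ *-monoˡ-≤ (ι-nonNeg (length (toList ℓ))) (∑-inv²-tail K d) ⟩
  L * inv (suc K)
    ∎
  where
  open ℚₚ.≤-Reasoning
  K₂ = suc (suc K)
  L = ι (length (toList ℓ))

∣average-eulerProduct<∣ : ∀ {ℓ} → All NonZero (toList ℓ) → ∀ K n .{{_ : NonZero n}} →
  ∣ average ℓ n - eulerProduct< ℓ (suc (suc K)) ∣ ℚ.≤
    ι (length (toList ℓ)) * inv (suc K) + inv n * ι (suc (primorial (suc (suc K))))
∣average-eulerProduct<∣ {ℓ} nz K n = begin
  ∣ average ℓ n - E ∣                       ≡⟨ cong ∣_∣ average-E ⟩
  ∣ inv n * (A - ι n * E) ∣                 ≡⟨ ℚₚ.∣p*q∣≡∣p∣*∣q∣ (inv n) (A - ι n * E) ⟩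
  ∣ inv n ∣ * ∣ A - ι n * E ∣               ≡⟨ cong (_* ∣ A - ι n * E ∣) (ℚₚ.0≤p⇒∣p∣≡p (inv-nonNeg n)) ⟩
  inv n * ∣ A - ι n * E ∣                   ≤⟨ *-monoˡ-≤ (inv-nonNeg n) ∣A-ι[n]*E∣≤ ⟩
  inv n * (L * ι n * i + (1ℚ + ι Q))         ≡⟨ solve 5 (λ j L c i q → j :* (L :* c :* i :+ q) := L :* i :* (c :* j) :+ j :* q)
                                                  refl (inv n) L (ι n) i (1ℚ + ι Q) ⟩
  L * i * (ι n * inv n) + inv n * (1ℚ + ι Q) ≡⟨ cong (λ z → L * i * z + inv n * (1ℚ + ι Q)) (ι*inv≡1 n) ⟩
  L * i * 1ℚ + inv n * (1ℚ + ι Q)            ≡⟨ cong (_+ inv n * (1ℚ + ι Q)) (ℚₚ.*-identityʳ (L * i)) ⟩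
  L * i + inv n * (1ℚ + ι Q)                 ∎
  where
  open ℚₚ.≤-Reasoning
  is = toList ℓ
  K₂ = suc (suc K)
  L = ι (length is)
  i = inv (suc K)
  Q = primorial K₂
  E = eulerProduct< ℓ K₂
  A = ∑[ m < n ] φ̃ℓ< is (suc (suc m)) (suc m)
  B = ∑[ m < n ] φ̃ℓ< is K₂ (suc m)
  C = ∑[ m < n ] φ̃ℓ< is K₂ m
  average-E : average ℓ n - E ≡ inv n * (A - ι n * E)
  average-E = begin-equality
    average ℓ n - E                 ≡⟨ cong (_- E) (average≡ ℓ n) ⟩
    inv n * A - E                   ≡⟨ cong (λ z → inv n * A - z) (ℚₚ.*-identityˡ E) ⟨
    inv n * A - 1ℚ * E              ≡⟨ cong (λ z → inv n * A - z * E) (ι*inv≡1 n) ⟨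
    inv n * A - (ι n * inv n) * E   ≡⟨ solve 4 (λ j a c e → j :* a :- (c :* j) :* e := j :* (a :- c :* e)) refl (inv n) A (ι n) E ⟩
    inv n * (A - ι n * E)           ∎
  ∣A-B∣≤ : ∣ A - B ∣ ℚ.≤ L * ι n * i
  ∣A-B∣≤ = begin
    ∣ A - B ∣      ≡⟨ trans (cong ∣_∣ (solve 2 (λ a b → a :- b := :- (b :- a)) refl A B)) (ℚₚ.∣-p∣≡∣p∣ (B - A)) ⟩
    ∣ B - A ∣      ≡⟨ cong ∣_∣ (∑-distrib-- n (λ m → φ̃ℓ< is K₂ (suc m)) (λ m → φ̃ℓ< is (suc (suc m)) (suc m))) ⟨
    ∣ (∑[ m < n ] (φ̃ℓ< is K₂ (suc m) - φ̃ℓ< is (suc (suc m)) (suc m))) ∣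
                   ≤⟨ ∈[0,r]⇒∣∣≤r (∑-φ̃ℓ<-truncation nz K n) ⟩
    L * ι n * i    ∎
  ∣A-ι[n]*E∣≤ : ∣ A - ι n * E ∣ ℚ.≤ L * ι n * i + (1ℚ + ι Q)
  ∣A-ι[n]*E∣≤ = begin
    ∣ A - ι n * E ∣                                 ≤⟨ ∣p-r∣≤∣p-q∣+∣q-r∣ A B (ι n * E) ⟩
    ∣ A - B ∣ + ∣ B - ι n * E ∣                     ≤⟨ ℚₚ.+-monoʳ-≤ ∣ A - B ∣ (∣p-r∣≤∣p-q∣+∣q-r∣ B C (ι n * E)) ⟩
    ∣ A - B ∣ + (∣ B - C ∣ + ∣ C - ι n * E ∣)       ≤⟨ ℚₚ.+-mono-≤ ∣A-B∣≤ (ℚₚ.+-mono-≤ (∣∑-shift-∑∣≤1 n (φ̃ℓ<-∈[0,1] is K₂))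
                                                                                 (∣∑φ̃ℓ<-ι*eulerProduct<∣≤primorial ℓ K₂ n)) ⟩
    L * ι n * i + (1ℚ + ι Q)                        ∎

∣average-partialProduct∣ : ∀ {ℓ} → All NonZero (toList ℓ) → ∀ K n P .{{_ : NonZero n}} → suc (suc K) ≤ suc P →
  ∣ average ℓ n - partialProduct ℓ P ∣ ℚ.≤
    (ι (length (toList ℓ)) * inv (suc K) + inv n * ι (suc (primorial (suc (suc K))))) + ι (length (toList ℓ)) * inv (suc K)
∣average-partialProduct∣ {ℓ} nz K n P K₂≤1+P = begin
  ∣ average ℓ n - partialProduct ℓ P ∣
    ≤⟨ ∣p-r∣≤∣p-q∣+∣q-r∣ (average ℓ n) (eulerProduct< ℓ K₂) (partialProduct ℓ P) ⟩
  ∣ average ℓ n - eulerProduct< ℓ K₂ ∣ + ∣ eulerProduct< ℓ K₂ - partialProduct ℓ P ∣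
    ≡⟨ cong (λ z → ∣ average ℓ n - eulerProduct< ℓ K₂ ∣ + ∣ eulerProduct< ℓ K₂ - z ∣) partialProduct≡ ⟩
  ∣ average ℓ n - eulerProduct< ℓ K₂ ∣ + ∣ eulerProduct< ℓ K₂ - eulerProduct< ℓ (K₂ ℕ.+ (suc P ℕ.∸ K₂)) ∣
    ≤⟨ ℚₚ.+-mono-≤ (∣average-eulerProduct<∣ nz K n) (∣eulerProduct<-eulerProduct<∣ nz K (suc P ℕ.∸ K₂)) ⟩
  (L * inv (suc K) + inv n * ι (suc (primorial K₂))) + L * inv (suc K)
    ∎
  where
  open ℚₚ.≤-Reasoning
  K₂ = suc (suc K)
  L = ι (length (toList ℓ))
  partialProduct≡ : partialProduct ℓ P ≡ eulerProduct< ℓ (K₂ ℕ.+ (suc P ℕ.∸ K₂))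
  partialProduct≡ = trans (partialProduct≡eulerProduct< ℓ P) (cong (eulerProduct< ℓ) (sym (ℕₚ.m+[n∸m]≡n K₂≤1+P)))

archimedean-inv : ∀ ε → 0ℚ < ε → ∃[ b ] inv (suc b) ℚ.≤ ε
archimedean-inv (mkℚ (ℤ.+ suc a) b _) _ = b , ℚₚ.toℚᵘ-cancel-≤
  (ℚᵘₚ.≤-respˡ-≃ (ℚᵘₚ.≃-sym (ℚₚ.toℚᵘ-fromℚᵘ (ℚᵘ.mkℚᵘ (ℤ.+ 1) b)))
    (ℚᵘ.*≤* (ℤ.+≤+ (ℕₚ.+-monoʳ-≤ 1 (ℕₚ.+-monoʳ-≤ b (ℕ.z≤n {a ℕ.* suc b}))))))
archimedean-inv (mkℚ (ℤ.+ zero) _ _) (ℚ.*<* (ℤ.+<+ ()))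
archimedean-inv (mkℚ ℤ.-[1+ _ ] _ _) (ℚ.*<* ())

3inv[4n]<inv[n] : ∀ n .{{_ : NonZero n}} → (inv (4 ℕ.* n) + inv (4 ℕ.* n)) + inv (4 ℕ.* n) < inv n
3inv[4n]<inv[n] n = begin-strict
  (δ + δ) + δ        ≡⟨ ℚₚ.+-identityʳ _ ⟨
  (δ + δ) + δ + 0ℚ   <⟨ ℚₚ.+-monoʳ-< ((δ + δ) + δ) (inv-pos (4 ℕ.* n) {{ℕₚ.m*n≢0 4 n}}) ⟩
  (δ + δ) + δ + δ    ≡⟨ solve 1 (λ δ → δ :+ δ :+ δ :+ δ := (con 1ℚ :+ (con 1ℚ :+ (con 1ℚ :+ (con 1ℚ :+ con 0ℚ)))) :* δ) refl δ ⟩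
  ι 4 * δ            ≡⟨ ι*inv[*]≡inv 4 n ⟩
  inv n              ∎
  where
  open ℚₚ.≤-Reasoning
  δ = inv (4 ℕ.* n)

∣average-partialProduct∣-eventually : ∀ {ℓ} → All NonZero (toList ℓ) → ∀ M .{{_ : NonZero M}} →
  ∃[ N ] ((n P : ℕ) → N ≤ n → N ≤ P → ∣ average ℓ n - partialProduct ℓ P ∣ ℚ.≤ (inv M + inv M) + inv M)
∣average-partialProduct∣-eventually {ℓ} nz M@(suc M') = N , bound
  where
  open ℚₚ.≤-Reasoning
  L = length (toList ℓ)
  -- suc K reduces to L * M, so that L * inv (suc K) is L * inv (L * M) = inv M.
  K = M' ℕ.+ length (List⁺.tail ℓ) ℕ.* M
  Q = primorial (suc (suc K))
  N = suc (suc K) ℕ.+ suc Q ℕ.* M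
  ι[L]*inv[1+K]≡inv[M] : ι L * inv (suc K) ≡ inv M
  ι[L]*inv[1+K]≡inv[M] = ι*inv[*]≡inv L M
  bound : (n P : ℕ) → N ≤ n → N ≤ P → ∣ average ℓ n - partialProduct ℓ P ∣ ℚ.≤ (inv M + inv M) + inv M
  bound n@(suc _) P N≤n N≤P = begin
    ∣ average ℓ n - partialProduct ℓ P ∣
      ≤⟨ ∣average-partialProduct∣ nz K n P (ℕₚ.m≤n⇒m≤1+n (ℕₚ.≤-trans (ℕₚ.m≤m+n (suc (suc K)) _) N≤P)) ⟩
    (ι L * inv (suc K) + inv n * ι (suc Q)) + ι L * inv (suc K)
      ≡⟨ cong₂ (λ x y → (x + inv n * ι (suc Q)) + y) ι[L]*inv[1+K]≡inv[M] ι[L]*inv[1+K]≡inv[M] ⟩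
    (inv M + inv n * ι (suc Q)) + inv M
      ≤⟨ ℚₚ.+-monoˡ-≤ (inv M) (ℚₚ.+-monoʳ-≤ (inv M) inv[n]*ι[1+Q]≤inv[M]) ⟩
    (inv M + inv M) + inv M
      ∎
    where
    inv[n]*ι[1+Q]≤inv[M] : inv n * ι (suc Q) ℚ.≤ inv M
    inv[n]*ι[1+Q]≤inv[M] = begin
      inv n * ι (suc Q)              ≤⟨ *-monoʳ-≤ (ι-nonNeg (suc Q)) (inv-antimono-≤ (ℕₚ.≤-trans (ℕₚ.m≤n+m (suc Q ℕ.* M) (suc (suc K))) N≤n)) ⟩
      inv (suc Q ℕ.* M) * ι (suc Q)  ≡⟨ ℚₚ.*-comm (inv (suc Q ℕ.* M)) (ι (suc Q)) ⟩
      ι (suc Q) * inv (suc Q ℕ.* M)  ≡⟨ ι*inv[*]≡inv (suc Q) M ⟩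
      inv M                          ∎

theorem2 : (ℓ : List⁺ ℕ) → All NonZero (toList ℓ) →
    (ε : ℚ) → 0ℚ < ε →
    ∃[ N ] ((n P : ℕ) → N ≤ n → N ≤ P →
      ∣ average ℓ n - partialProduct ℓ P ∣ < ε)
theorem2 ℓ nz ε 0<ε = N , λ n P N≤n N≤P → begin-strict
  ∣ average ℓ n - partialProduct ℓ P ∣  ≤⟨ proj₂ close n P N≤n N≤P ⟩
  (δ + δ) + δ                          <⟨ 3inv[4n]<inv[n] (suc b) ⟩
  inv (suc b)                          ≤⟨ proj₂ (archimedean-inv ε 0<ε) ⟩
  ε                                    ∎
  where
  open ℚₚ.≤-Reasoning
  b = proj₁ (archimedean-inv ε 0<ε)
  δ = inv (4 ℕ.* suc b)
  close = ∣average-partialProduct∣-eventually nz (4 ℕ.* suc b)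
  N = proj₁ close
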